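{- For all $\mathrm{MTL}$ formulas $\varphi,\psi$ and every valuation $(K,T)$: $(K,T)\models\Diamond(\varphi\otimes\psi)$ if and only if $(K,T)\models\Diamond\varphi\otimes\Diamond\psi$.
   Context: $\mathrm{ML}$: modal formulas over a countably infinite set of propositional variables with $\neg,\to,\Box$. $\mathrm{MTL}$: closure of $\mathrm{ML}$ under $\sim$, $\rightarrowtail$, $\multimap$, $\Box$, $\Delta$. Valuations $(K,T)$: $K=(W,R,V)$ a Kripke structure, $T\subseteq W$. $\mathrm{ML}$ formulas hold iff they hold at every $w\in T$; $\sim\varphi$ iff $\varphi$ fails; $\varphi\rightarrowtail\psi$ iff $\varphi$ fails or $\psi$ holds; $(K,T)\models\varphi\multimap\psi$ iff for all $S,U$ with $S\cup U=T$, $(K,S)\models\varphi$ implies $(K,U)\models\psi$; $\varphi\otimes\psi:=\sim(\varphi\multimap\sim\psi)$ (so $(K,T)\models\varphi\otimes\psi$ iff there are $S\cup U=T$ with $(K,S)\models\varphi$, $(K,U)\models\psi$); $(K,T)\models\Box\varphi$ iff $(K,R[T])\models\varphi$, $R[T]$ the set of all successors of worlds in $T$; $(K,T)\models\Delta\varphi$ iff $(K,T')\models\varphi$ for every successor team $T'$ of $T$ (each $w\in T$ has a successor in $T'$ and each $v\in T'$ has a predecessor in $T$); $\Diamond\varphi:=\sim\Delta\sim\varphi$. -}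

module Defs where

open import Level using (0ℓ)
open import Data.Nat using (ℕ)
open import Data.Product using (_×_; ∃; ∃-syntax; _,_)
open import Data.Sum using (_⊎_)
open import Relation.Nullary using (¬_)
open import Relation.Unary using (Pred; _∪_; _≐_)

record Kripke : Set₁ where
  field
    W : Set
    R : W → W → Set
    V : ℕ → Pred W 0ℓ
open Kripke public

Team : Kripke → Set₁
Team K = Pred (W K) 0ℓ

data ML : Set where
  var  : ℕ → ML
  ¬ₘ_  : ML → ML
  _⇒ₘ_ : ML → ML → ML
  □ₘ_  : ML → ML

_,_⊩_ : (K : Kripke) → W K → ML → Set
K , w ⊩ var p    = V K p w
K , w ⊩ (¬ₘ φ)   = ¬ (K , w ⊩ φ)
K , w ⊩ (φ ⇒ₘ ψ) = K , w ⊩ φ → K , w ⊩ ψ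
K , w ⊩ (□ₘ φ)   = ∀ v → R K w v → K , v ⊩ φ

data MTL : Set where
  ml   : ML → MTL
  ∼_   : MTL → MTL
  _↣_  : MTL → MTL → MTL
  _⊸_  : MTL → MTL → MTL
  □_   : MTL → MTL
  Δ_   : MTL → MTL

Img : (K : Kripke) → Team K → Team K
Img K T v = ∃[ w ] (T w × R K w v)

SuccTeam : (K : Kripke) → Team K → Team K → Set
SuccTeam K T T' =
  (∀ w → T w → ∃[ v ] (R K w v × T' v)) ×
  (∀ v → T' v → ∃[ w ] (R K w v × T w))

_,_⊨_ : (K : Kripke) → Team K → MTL → Set₁
K , T ⊨ ml φ    = Level.Lift _ (∀ w → T w → K , w ⊩ φ)
K , T ⊨ (∼ φ)   = ¬ (K , T ⊨ φ)
K , T ⊨ (φ ↣ ψ) = ¬ (K , T ⊨ φ) ⊎ (K , T ⊨ ψ)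
K , T ⊨ (φ ⊸ ψ) = (S U : Team K) → (S ∪ U) ≐ T → K , S ⊨ φ → K , U ⊨ ψ
K , T ⊨ (□ φ)   = K , Img K T ⊨ φ
K , T ⊨ (Δ φ)   = (T' : Team K) → SuccTeam K T T' → K , T' ⊨ φ

_⊗_ : MTL → MTL → MTL
φ ⊗ ψ = ∼ (φ ⊸ (∼ ψ))

◇_ : MTL → MTL
◇ φ = ∼ (Δ (∼ φ))

infixr 6 _⊗_

module Submission where

-- Both ◇ and ⊗ are negations of universal statements, so each has a
-- constructive introduction rule from an explicit witness (a successor
-- team, resp. a covering split of the team), and any goal that is itself
-- a negation may eliminate them by applying the hypothesis to a
-- continuation.  The theorem therefore reduces to two facts about teams:
--
--  * splitting downstairs (→): if T' is a successor team of T and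
--    S' ∪ U' = T', then the R-preimages of S' and U' inside T cover T and
--    have S' and U' as successor teams;
--  * gluing (←): if S ∪ U = T and S', U' are successor teams of S, U,
--    then S' ∪ U' is a successor team of T.

open import Defs
open import Data.Product using (_×_; _,_; proj₁; proj₂; ∃-syntax)
open import Data.Sum using (inj₁; inj₂)
open import Function using (id)
open import Relation.Unary using (_∪_; _≐_; _⊆_)

module _ (K : Kripke) where

  ◇-intro : (φ : MTL) {T T' : Team K} →
            SuccTeam K T T' → K , T' ⊨ φ → K , T ⊨ (◇ φ)
  ◇-intro φ {T' = T'} st T'⊨φ noWitness = noWitness T' st T'⊨φ

  ⊗-intro : (φ ψ : MTL) {T S U : Team K} →
            (S ∪ U) ≐ T → K , S ⊨ φ → K , U ⊨ ψ → K , T ⊨ (φ ⊗ ψ)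
  ⊗-intro φ ψ {S = S} {U} cov S⊨φ U⊨ψ noSplit = noSplit S U cov S⊨φ U⊨ψ

  Pre : Team K → Team K → Team K
  Pre T X w = T w × ∃[ v ] (R K w v × X v)

  pre-succTeam : (T X : Team K) →
                 (∀ v → X v → ∃[ w ] (R K w v × T w)) →
                 SuccTeam K (Pre T X) X
  pre-succTeam T X hasPred = (λ w → proj₂) , back
    where
    back : ∀ v → X v → ∃[ w ] (R K w v × Pre T X w)
    back v xv with hasPred v xv
    ... | w , wRv , tw = w , wRv , tw , v , wRv , xv

  pre-cover : (T T' S' U' : Team K) →
              (∀ w → T w → ∃[ v ] (R K w v × T' v)) →
              (S' ∪ U') ≐ T' → (Pre T S' ∪ Pre T U') ≐ T
  pre-cover T T' S' U' hasSucc (_ , T'⊆S'∪U') = Pre⊆T , T⊆Pre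
    where
    Pre⊆T : (Pre T S' ∪ Pre T U') ⊆ T
    Pre⊆T (inj₁ (tw , _)) = tw
    Pre⊆T (inj₂ (tw , _)) = tw

    T⊆Pre : T ⊆ (Pre T S' ∪ Pre T U')
    T⊆Pre {w} tw with hasSucc w tw
    ... | v , wRv , t'v with T'⊆S'∪U' t'v
    ...   | inj₁ s'v = inj₁ (tw , v , wRv , s'v)
    ...   | inj₂ u'v = inj₂ (tw , v , wRv , u'v)

  succTeam-∪ : (T S U S' U' : Team K) → (S ∪ U) ≐ T →
               SuccTeam K S S' → SuccTeam K U U' → SuccTeam K T (S' ∪ U')
  succTeam-∪ T S U S' U' (S∪U⊆T , T⊆S∪U) (fwdS , backS) (fwdU , backU) =
    fwd , back
    where
    fwd : ∀ w → T w → ∃[ v ] (R K w v × (S' ∪ U') v)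
    fwd w tw with T⊆S∪U tw
    ... | inj₁ sw = let v , wRv , s'v = fwdS w sw in v , wRv , inj₁ s'v
    ... | inj₂ uw = let v , wRv , u'v = fwdU w uw in v , wRv , inj₂ u'v

    back : ∀ v → (S' ∪ U') v → ∃[ w ] (R K w v × T w)
    back v (inj₁ s'v) = let w , wRv , sw = backS v s'v in w , wRv , S∪U⊆T (inj₁ sw)
    back v (inj₂ u'v) = let w , wRv , uw = backU v u'v in w , wRv , S∪U⊆T (inj₂ uw)

lemma46 : (φ ψ : MTL) (K : Kripke) (T : Team K) →
    ((K , T ⊨ (◇ (φ ⊗ ψ))) → (K , T ⊨ ((◇ φ) ⊗ (◇ ψ)))) ×
    ((K , T ⊨ ((◇ φ) ⊗ (◇ ψ))) → (K , T ⊨ (◇ (φ ⊗ ψ))))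
lemma46 φ ψ K T = split , glue
  where
  split : K , T ⊨ (◇ (φ ⊗ ψ)) → K , T ⊨ ((◇ φ) ⊗ (◇ ψ))
  split ◇φ⊗ψ goal = ◇φ⊗ψ λ T' (fwd , back) T'⊨φ⊗ψ →
    T'⊨φ⊗ψ λ S' U' cov@(S'∪U'⊆T' , _) S'⊨φ U'⊨ψ →
      let S'-hasPred = λ v s'v → back v (S'∪U'⊆T' (inj₁ s'v))
          U'-hasPred = λ v u'v → back v (S'∪U'⊆T' (inj₂ u'v))
      in ⊗-intro K (◇ φ) (◇ ψ) (pre-cover K T T' S' U' fwd cov)
           (◇-intro K φ (pre-succTeam K T S' S'-hasPred) S'⊨φ)
           (◇-intro K ψ (pre-succTeam K T U' U'-hasPred) U'⊨ψ)
           goal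

  glue : K , T ⊨ ((◇ φ) ⊗ (◇ ψ)) → K , T ⊨ (◇ (φ ⊗ ψ))
  glue ◇φ⊗◇ψ goal = ◇φ⊗◇ψ λ S U cov ◇φ ◇ψ →
    ◇φ λ S' stS S'⊨φ → ◇ψ λ U' stU U'⊨ψ →
      ◇-intro K (φ ⊗ ψ) (succTeam-∪ K T S U S' U' cov stS stU)
        (⊗-intro K φ ψ (id , id) S'⊨φ U'⊨ψ)
        goal
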